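{- Let $H_e(M,2^r3^s,l)=M\rtimes Z$, with $Z=\langle z\rangle\cong\mathbb{Z}_{2^r3^s}$, be a group of type $e$ which is a CI-group. Then $H_e(M,2^r3^s,l)$ does not have the $k$-if property for any integer $k\geq2$.
   Context: Definition of $H_e(M,2^r3^s,l)$: let $M$ be a finite abelian group all of whose Sylow subgroups are homocyclic, $m$ the exponent of $M$, $l$ an integer with $1\leq l\leq m$ and $\gcd(l(l-1),m)=1$, and $e$ the least positive integer with $l^e\equiv1\pmod m$. Let $r,s\geq0$ be integers such that one of the following holds: $e=2$, $r\geq1$, $s=0$, $m$ odd; $e=3$, $r=0$, $s\geq1$, $3\nmid m$; $e=4$, $r\geq2$, $s=0$, $m$ odd; $e=6$, $r\geq1$, $s\geq1$, $\gcd(m,6)=1$. Then $H_e(M,2^r3^s,l)=\langle M,z\mid z^{2^r3^s}=1,\ x^z=x^l\ \forall x\in M\rangle$, said to be of type $e$. For a finite group $G$ let $G^*=G\setminus\{1\}$; for inverse-closed $S\subseteq G^*$, $\mathrm{Cay}(G,S)$ has vertex set $G$ and edges $\{h,g\}$ with $gh^{ -1}\in S$. $G$ is a CI-group if for all inverse-closed $S,T\subseteq G^*$, $\mathrm{Cay}(G,S)\cong\mathrm{Cay}(G,T)$ implies $T=S^{\alpha}$ for some $\alpha\in\mathrm{Aut}(G)$. A partition of a set is a collection of non-empty pairwise disjoint subsets whose union is the set. $\mathrm{Cay}(G,S)$ is a $k$-if Cayley graph if there is a partition $\{S_0=S,\dots,S_{k-1}\}$ of $G^*$ into inverse-closed subsets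 with $\mathrm{Cay}(G,S_i)\cong\mathrm{Cay}(G,S)$ for all $i$; $G$ has the $k$-if property if some $\mathrm{Cay}(G,S)$ is a $k$-if Cayley graph. -}

module Defs where

open import Data.Nat using (ℕ; zero; suc; _+_; _*_; _∸_; _^_; _≤_; _<_; NonZero)
open import Data.Nat.Properties using (m^n≢0; m*n≢0)
open import Data.Nat.DivMod using (_mod_)
open import Data.Nat.Divisibility using (_∣_)
open import Data.Nat.Coprimality using (Coprime)
open import Data.Nat.Primality using (Prime)
open import Data.Nat.LCM using (lcm)
open import Data.Fin using (Fin; toℕ)
open import Data.List using (List; []; _∷_; length; lookup; foldr)
open import Data.List.Relation.Unary.All using (All; []; _∷_)
open import Data.Product using (Σ; ∃; _×_; _,_)
open import Data.Sum using (_⊎_)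
open import Data.Unit using (⊤; tt)
open import Data.Bool using (Bool; true; false)
open import Relation.Nullary using (¬_)
open import Relation.Binary.PropositionalEquality using (_≡_; _≢_)
open import Function.Definitions using (Bijective)

module GroupNotions {G : Set} (_∙_ : G → G → G) (ε : G) (_⁻¹ : G → G) where

  Subset : Set
  Subset = G → Bool

  InvClosedNonId : Subset → Set
  InvClosedNonId S = (S ε ≡ false) × (∀ g → S g ≡ true → S (g ⁻¹) ≡ true)

  -- Cay(G,S) ≅ Cay(G,T): a bijection of vertex sets G preserving
  -- adjacency and non-adjacency ({h,g} is an edge iff g h⁻¹ ∈ S).
  CayIso : Subset → Subset → Set
  CayIso S T = Σ (G → G) λ φ → Bijective _≡_ _≡_ φ ×
               (∀ g h → S (g ∙ (h ⁻¹)) ≡ T (φ g ∙ ((φ h) ⁻¹)))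

  IsAut : (G → G) → Set
  IsAut α = Bijective _≡_ _≡_ α × (∀ g h → α (g ∙ h) ≡ α g ∙ α h)

  -- S^α = { α s | s ∈ S }; since α is bijective, T = S^α iff T (α g) = S g for all g
  IsCIGroup : Set
  IsCIGroup = (S T : Subset) → InvClosedNonId S → InvClosedNonId T → CayIso S T →
              Σ (G → G) λ α → IsAut α × (∀ g → T (α g) ≡ S g)

  IsInvClosedPartition : (k : ℕ) → (Fin k → Subset) → Set
  IsInvClosedPartition k P =
    (∀ i → InvClosedNonId (P i)) ×
    (∀ i → ∃ λ g → P i g ≡ true) ×
    (∀ i j g → i ≢ j → P i g ≡ true → P j g ≡ false) ×
    (∀ g → g ≢ ε → ∃ λ i → P i g ≡ true)

  IsKIfCayley : ℕ → Subset → Set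
  IsKIfCayley k S = Σ (Fin k → Subset) λ P → IsInvClosedPartition k P ×
                    (∃ λ i₀ → ∀ g → P i₀ g ≡ S g) ×
                    (∀ i → CayIso (P i) S)

  HasKIfProperty : ℕ → Set
  HasKIfProperty k = Σ Subset λ S → IsKIfCayley k S

addF : ∀ {q} → Fin q → Fin q → Fin q
addF {suc q} a b = (toℕ a + toℕ b) mod suc q

scaleF : ∀ {q} → ℕ → Fin q → Fin q
scaleF {suc q} c a = (c * toℕ a) mod suc q

negF : ∀ {q} → Fin q → Fin q
negF {suc q} a = (suc q ∸ toℕ a) mod suc q

zeroF : (q : ℕ) → .{{NonZero q}} → Fin q
zeroF q = 0 mod q

-- The finite abelian group M = Z_{q₁} × … × Z_{q_t}, written additively.

Elt : List ℕ → Set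
Elt []       = ⊤
Elt (q ∷ qs) = Fin q × Elt qs

addE : ∀ qs → Elt qs → Elt qs → Elt qs
addE []       _       _       = tt
addE (q ∷ qs) (a , x) (b , y) = addF a b , addE qs x y

scaleE : ∀ qs → ℕ → Elt qs → Elt qs
scaleE []       c _       = tt
scaleE (q ∷ qs) c (a , x) = scaleF c a , scaleE qs c x

negE : ∀ qs → Elt qs → Elt qs
negE []       _       = tt
negE (q ∷ qs) (a , x) = negF a , negE qs x

zeroE : ∀ qs → All NonZero qs → Elt qs
zeroE []       []         = tt
zeroE (q ∷ qs) (nz ∷ nzs) = zeroF q {{nz}} , zeroE qs nzs

PrimePowerFactors : List ℕ → Set
PrimePowerFactors qs = ∀ i → Σ ℕ λ p → Σ ℕ λ a → Prime p × 1 ≤ a × lookup qs i ≡ p ^ a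

HomocyclicSylows : List ℕ → Set
HomocyclicSylows qs = ∀ i j p a b → Prime p → 1 ≤ a → 1 ≤ b →
                      lookup qs i ≡ p ^ a → lookup qs j ≡ p ^ b → a ≡ b

exponent : List ℕ → ℕ
exponent qs = foldr lcm 1 qs

-- The element (a , x) stands for z^a x
-- (a ∈ Z_{2^r 3^s}, x ∈ M).  With z⁻¹ x z = x^l (i.e. l·x additively):
--   (z^a x)(z^b y) = z^(a+b) (z^{-b} x z^b) y = z^(a+b) (l^b·x + y).

ordZ : ℕ → ℕ → ℕ
ordZ r s = 2 ^ r * 3 ^ s

ordZ-nz : ∀ r s → NonZero (ordZ r s)
ordZ-nz r s = m*n≢0 (2 ^ r) (3 ^ s) {{m^n≢0 2 r}} {{m^n≢0 3 s}}

HCarrier : List ℕ → ℕ → ℕ → Set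
HCarrier qs r s = Fin (ordZ r s) × Elt qs

Hmul : ∀ qs r s (l : ℕ) → HCarrier qs r s → HCarrier qs r s → HCarrier qs r s
Hmul qs r s l (a , x) (b , y) = addF a b , addE qs (scaleE qs (l ^ toℕ b) x) y

Hinv : ∀ qs r s (l : ℕ) → HCarrier qs r s → HCarrier qs r s
Hinv qs r s l (a , x) = negF a , negE qs (scaleE qs (l ^ toℕ (negF a)) x)

Hone : ∀ qs → All NonZero qs → ∀ r s → HCarrier qs r s
Hone qs nzs r s = zeroF (ordZ r s) {{ordZ-nz r s}} , zeroE qs nzs

module H (qs : List ℕ) (nzs : All NonZero qs) (r s l : ℕ) =
  GroupNotions (Hmul qs r s l) (Hone qs nzs r s) (Hinv qs r s l)

IsMultOrder : ℕ → ℕ → ℕ → Set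
IsMultOrder m l e = 1 ≤ e × m ∣ (l ^ e ∸ 1) × (∀ f → 1 ≤ f → f < e → ¬ (m ∣ (l ^ f ∸ 1)))

TypeCondition : (m e r s : ℕ) → Set
TypeCondition m e r s =
    (e ≡ 2 × 1 ≤ r × s ≡ 0 × ¬ (2 ∣ m))
  ⊎ (e ≡ 3 × r ≡ 0 × 1 ≤ s × ¬ (3 ∣ m))
  ⊎ (e ≡ 4 × 2 ≤ r × s ≡ 0 × ¬ (2 ∣ m))
  ⊎ (e ≡ 6 × 1 ≤ r × 1 ≤ s × Coprime m 6)

{-# OPTIONS --safe #-}
module Submission where

-- Let G = H_e(M, 2^r 3^s, l) = M ⋊ ⟨z⟩ and let Cay(G, S) be a k-if Cayley graph with parts
-- S₀, …, S_{k-1}. By the CI property each part is an automorphic image of S, so every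
-- Aut(G)-invariant subset of G ∖ {1} meets all parts equally often and its size is divisible by k.
-- Since y ↦ y^(l-1) is onto M, the commutators of G are exactly the elements of M; hence
-- C = C_G(M) and its coset zC = {g : g⁻¹xg = x^l for all x ∈ M} are Aut(G)-invariant.
-- As M ≠ 1 and l ≢ 1 on M, we have 1 ∈ C but 1 ∉ zC, so k divides both |zC| = |C| and |C| - 1.

open import Defs
open import Data.Bool.Base using (Bool; true; false; _∧_; not)
open import Data.Bool.Properties using (∧-zeroʳ; ∧-identityʳ)
open import Data.Fin.Base using (Fin; zero; toℕ; punchIn)
open import Data.Fin.Properties
  using (toℕ-fromℕ<; toℕ-injective; toℕ<n; toℕ≤n; punchInᵢ≢i; *↔×; 1↔⊤)
  renaming (_≟_ to _≟ᶠ_; all? to allᶠ?)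
open import Data.List.Base using (List; []; _∷_)
open import Data.List.Relation.Unary.All as All using (All; []; _∷_)
open import Data.Nat.Base
open import Data.Nat.Coprimality using (Coprime; coprime-Bézout)
open import Data.Nat.DivMod
open import Data.Nat.Divisibility
  using (_∣_; divides; ∣-refl; ∣-trans; 1∣_; m∣m*n; *-pres-∣; ∣1⇒≡1; ∣m+n∣m⇒∣n)
open import Data.Nat.GCD using (module Bézout)
open import Data.Nat.LCM using (m∣lcm[m,n]; n∣lcm[m,n])
open import Data.Nat.ListAction using (product)
open import Data.Nat.Primality using (Prime; prime⇒nonTrivial)
open import Data.Nat.Properties
  using ( +-comm; +-assoc; +-identityʳ; *-comm; *-assoc; *-identityˡ; *-identityʳ
        ; ^-distribˡ-+-*; ^-*-assoc; m^n>0; m*n≡1⇒m≡1; m∸n+n≡m; m+[n∸m]≡n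
        ; ≤-refl; ≤-trans; ≤∧≢⇒<; <⇒≢; 0≢1+n; +-0-commutativeMonoid )
open import Data.Nat.Tactic.RingSolver using (solve-∀)
open import Data.Product.Base using (∃; ∃₂; _,_; proj₁; proj₂; map₂)
open import Data.Product.Function.NonDependent.Propositional using (_×-↔_)
open import Data.Product.Properties using (,-injectiveˡ; ,-injectiveʳ)
open import Data.Sum.Base using (inj₁; inj₂)
open import Function.Base using (_∘_)
open import Function.Bundles using (_↔_; _⇔_; mk⇔; mk↔ₛ′; mk⤖; Equivalence; Inverse)
open import Function.Construct.Composition using (_↔-∘_)
open import Function.Construct.Identity using (↔-id)
open import Function.Construct.Symmetry using (↔-sym; ⇔-sym)
open import Function.Properties.Bijection using (⤖⇒↔)
open import Function.Properties.Inverse using (↔⇒↣)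
open import Relation.Binary.Definitions using (DecidableEquality)
open import Relation.Binary.PropositionalEquality
open import Relation.Nullary.Decidable
  using (Dec; yes; no; does; map′; dec-true; dec-false; does-⇔; via-injection)
import Relation.Nullary.Decidable as Dec
open import Relation.Nullary.Negation using (¬_)

open import Algebra.Properties.CommutativeMonoid.Sum +-0-commutativeMonoid
  using (sum; sum-remove; sum-cong-≗; sum-replicate-zero; ∑-comm; ∑-distrib-+; sum-permute)

-- Arithmetic modulo q

module _ {q : ℕ} .{{_ : NonZero q}} where

  %-cong-+ : ∀ {a b c d} → a % q ≡ b % q → c % q ≡ d % q → (a + c) % q ≡ (b + d) % q
  %-cong-+ {a} {b} {c} {d} a≡b c≡d = begin
    (a + c) % q         ≡⟨ %-distribˡ-+ a c q ⟩
    (a % q + c % q) % q ≡⟨ cong₂ (λ x y → (x + y) % q) a≡b c≡d ⟩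
    (b % q + d % q) % q ≡⟨ %-distribˡ-+ b d q ⟨
    (b + d) % q         ∎
    where open ≡-Reasoning

  %-cong-* : ∀ {a b c d} → a % q ≡ b % q → c % q ≡ d % q → (a * c) % q ≡ (b * d) % q
  %-cong-* {a} {b} {c} {d} a≡b c≡d = begin
    (a * c) % q           ≡⟨ %-distribˡ-* a c q ⟩
    (a % q * (c % q)) % q ≡⟨ cong₂ (λ x y → (x * y) % q) a≡b c≡d ⟩
    (b % q * (d % q)) % q ≡⟨ %-distribˡ-* b d q ⟨
    (b * d) % q           ∎
    where open ≡-Reasoning

  ^-%-one : ∀ {a} t → a % q ≡ 1 % q → a ^ t % q ≡ 1 % q
  ^-%-one zero    _   = refl
  ^-%-one (suc t) a≡1 = %-cong-* a≡1 (^-%-one t a≡1)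

module _ {l n m : ℕ} .{{_ : NonZero n}} .{{_ : NonZero m}} (l^n≡1 : l ^ n % m ≡ 1 % m) where

  ^-%-reduce : ∀ a → l ^ a % m ≡ l ^ (a % n) % m
  ^-%-reduce a = begin
    l ^ a % m                               ≡⟨ cong (λ t → l ^ t % m) (m≡m%n+[m/n]*n a n) ⟩
    l ^ (a % n + a / n * n) % m             ≡⟨ cong (_% m) (^-distribˡ-+-* l (a % n) (a / n * n)) ⟩
    l ^ (a % n) * l ^ (a / n * n) % m       ≡⟨ cong (λ t → l ^ (a % n) * l ^ t % m) (*-comm (a / n) n) ⟩
    l ^ (a % n) * l ^ (n * (a / n)) % m     ≡⟨ cong (λ t → l ^ (a % n) * t % m) (^-*-assoc l n (a / n)) ⟨
    l ^ (a % n) * (l ^ n) ^ (a / n) % m     ≡⟨ %-cong-* {a = l ^ (a % n)} refl (^-%-one (a / n) l^n≡1) ⟩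
    l ^ (a % n) * 1 % m                     ≡⟨ cong (_% m) (*-identityʳ (l ^ (a % n))) ⟩
    l ^ (a % n) % m                         ∎
    where open ≡-Reasoning

  ^-cong-% : ∀ {a b} → a % n ≡ b % n → l ^ a % m ≡ l ^ b % m
  ^-cong-% {a} {b} a≡b = trans (^-%-reduce a) (trans (cong (λ t → l ^ t % m) a≡b) (sym (^-%-reduce b)))

coprime⇒inverse : ∀ {q c} .{{_ : NonZero q}} → Coprime c q → ∃ λ u → c * u % q ≡ 1 % q
coprime⇒inverse {suc q} {c} c⊥q with coprime-Bézout c⊥q
... | Bézout.+- x y eq = x , (begin
  c * x % suc q             ≡⟨ cong (_% suc q) (trans (*-comm c x) (sym eq)) ⟩
  (1 + y * suc q) % suc q   ≡⟨ [m+kn]%n≡m%n 1 y (suc q) ⟩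
  1 % suc q                 ∎)
  where open ≡-Reasoning
... | Bézout.-+ x y eq = q * x , (begin
  c * (q * x) % suc q                 ≡⟨ [m+kn]%n≡m%n (c * (q * x)) y (suc q) ⟨
  (c * (q * x) + y * suc q) % suc q   ≡⟨ cong (λ t → (c * (q * x) + t) % suc q) eq ⟨
  (c * (q * x) + (1 + x * c)) % suc q ≡⟨ cong (_% suc q) (regroup c q x) ⟩
  (1 + x * c * suc q) % suc q         ≡⟨ [m+kn]%n≡m%n 1 (x * c) (suc q) ⟩
  1 % suc q                           ∎)
  where
  open ≡-Reasoning
  -- x c ≡ -1 modulo q + 1, so c (q x) ≡ (-1)(-1) = 1
  regroup : ∀ c q x → c * (q * x) + (1 + x * c) ≡ 1 + x * c * suc q
  regroup = solve-∀

-- The cyclic groups ℤ/q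

-- A record rather than a synonym for the equation, so that q, a and x stay inferable.
infix 4 _∼_
record _∼_ {q : ℕ} .{{_ : NonZero q}} (a : Fin q) (x : ℕ) : Set where
  constructor residue
  field toℕ-% : toℕ a % q ≡ x % q

module _ {q : ℕ} .{{_ : NonZero q}} where

  ∼⇒≡ : ∀ {a b : Fin q} {x y} → a ∼ x → b ∼ y → x % q ≡ y % q → a ≡ b
  ∼⇒≡ {a} {b} (residue a∼x) (residue b∼y) x≡y = toℕ-injective (begin
    toℕ a      ≡⟨ m<n⇒m%n≡m (toℕ<n a) ⟨
    toℕ a % q  ≡⟨ trans a∼x (trans x≡y (sym b∼y)) ⟩
    toℕ b % q  ≡⟨ m<n⇒m%n≡m (toℕ<n b) ⟩
    toℕ b      ∎)
    where open ≡-Reasoning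

  toℕ-∼ : {a : Fin q} → a ∼ toℕ a
  toℕ-∼ = residue refl

  mod-∼ : ∀ x → x mod q ∼ x
  mod-∼ x = residue (trans (cong (_% q) (toℕ-fromℕ< (m%n<n x q))) (m%n%n≡m%n x q))

  zeroF-∼ : zeroF q ∼ 0
  zeroF-∼ = mod-∼ 0

  toℕ-zeroF : toℕ (zeroF q) ≡ 0
  toℕ-zeroF = trans (toℕ-fromℕ< (m%n<n 0 q)) (m<n⇒m%n≡m (>-nonZero⁻¹ q))

addF-∼ : ∀ {q} .{{_ : NonZero q}} {a b : Fin q} {x y} → a ∼ x → b ∼ y → addF a b ∼ x + y
addF-∼ {suc q} {a} {b} {x} {y} (residue a∼x) (residue b∼y) = residue
  (trans (_∼_.toℕ-% (mod-∼ (toℕ a + toℕ b))) (%-cong-+ {a = toℕ a} {x} {toℕ b} {y} a∼x b∼y))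

scaleF-∼ : ∀ {q} .{{_ : NonZero q}} c {a : Fin q} {x} → a ∼ x → scaleF c a ∼ c * x
scaleF-∼ {suc q} c {a} {x} (residue a∼x) = residue
  (trans (_∼_.toℕ-% (mod-∼ (c * toℕ a))) (%-cong-* {a = c} {c} {toℕ a} {x} refl a∼x))

negF-∼ : ∀ {q} .{{_ : NonZero q}} (a : Fin q) → negF a ∼ q ∸ toℕ a
negF-∼ {suc q} a = mod-∼ (suc q ∸ toℕ a)

addF-comm : ∀ {q} .{{_ : NonZero q}} (a b : Fin q) → addF a b ≡ addF b a
addF-comm {q} a b = ∼⇒≡ (addF-∼ toℕ-∼ toℕ-∼) (addF-∼ toℕ-∼ toℕ-∼) (cong (_% q) (+-comm (toℕ a) (toℕ b)))

addF-assoc : ∀ {q} .{{_ : NonZero q}} (a b c : Fin q) → addF (addF a b) c ≡ addF a (addF b c)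
addF-assoc {q} a b c = ∼⇒≡ (addF-∼ (addF-∼ toℕ-∼ toℕ-∼) toℕ-∼) (addF-∼ toℕ-∼ (addF-∼ toℕ-∼ toℕ-∼))
  (cong (_% q) (+-assoc (toℕ a) (toℕ b) (toℕ c)))

addF-identityˡ : ∀ {q} .{{_ : NonZero q}} (a : Fin q) → addF (zeroF q) a ≡ a
addF-identityˡ {q} a = ∼⇒≡ (addF-∼ zeroF-∼ toℕ-∼) toℕ-∼ refl

addF-identityʳ : ∀ {q} .{{_ : NonZero q}} (a : Fin q) → addF a (zeroF q) ≡ a
addF-identityʳ a = trans (addF-comm a _) (addF-identityˡ a)

addF-inverseˡ : ∀ {q} .{{_ : NonZero q}} (a : Fin q) → addF (negF a) a ≡ zeroF q
addF-inverseˡ {q} a = ∼⇒≡ (addF-∼ (negF-∼ a) toℕ-∼) zeroF-∼ (begin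
  (q ∸ toℕ a + toℕ a) % q ≡⟨ cong (_% q) (m∸n+n≡m (toℕ≤n a)) ⟩
  q % q                   ≡⟨ n%n≡0 q ⟩
  0                       ≡⟨ m<n⇒m%n≡m (>-nonZero⁻¹ q) ⟨
  0 % q                   ∎)
  where open ≡-Reasoning

addF-inverseʳ : ∀ {q} .{{_ : NonZero q}} (a : Fin q) → addF a (negF a) ≡ zeroF q
addF-inverseʳ a = trans (addF-comm a (negF a)) (addF-inverseˡ a)

negF-addF-cancel : ∀ {q} .{{_ : NonZero q}} (a b : Fin q) → addF (negF a) (addF a b) ≡ b
negF-addF-cancel a b = begin
  addF (negF a) (addF a b) ≡⟨ addF-assoc (negF a) a b ⟨
  addF (addF (negF a) a) b ≡⟨ cong (λ t → addF t b) (addF-inverseˡ a) ⟩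
  addF (zeroF _) b         ≡⟨ addF-identityˡ b ⟩
  b                        ∎
  where open ≡-Reasoning

addF-negF-cancel : ∀ {q} .{{_ : NonZero q}} (a b : Fin q) → addF a (addF (negF a) b) ≡ b
addF-negF-cancel a b = begin
  addF a (addF (negF a) b) ≡⟨ addF-assoc a (negF a) b ⟨
  addF (addF a (negF a)) b ≡⟨ cong (λ t → addF t b) (addF-inverseʳ a) ⟩
  addF (zeroF _) b         ≡⟨ addF-identityˡ b ⟩
  b                        ∎
  where open ≡-Reasoning

addF-cancelˡ : ∀ {q} .{{_ : NonZero q}} (c : Fin q) {a b : Fin q} → addF c a ≡ addF c b → a ≡ b
addF-cancelˡ c {a} {b} ca≡cb =
  trans (sym (negF-addF-cancel c a)) (trans (cong (addF (negF c)) ca≡cb) (negF-addF-cancel c b))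

scaleF-identityˡ : ∀ {q} .{{_ : NonZero q}} (a : Fin q) → scaleF 1 a ≡ a
scaleF-identityˡ {q} a = ∼⇒≡ (scaleF-∼ 1 toℕ-∼) toℕ-∼ (cong (_% q) (*-identityˡ (toℕ a)))

scaleF-zeroˡ : ∀ {q} .{{_ : NonZero q}} (a : Fin q) → scaleF 0 a ≡ zeroF q
scaleF-zeroˡ a = ∼⇒≡ (scaleF-∼ 0 toℕ-∼) zeroF-∼ refl

scaleF-suc : ∀ {q} .{{_ : NonZero q}} c (a : Fin q) → addF (scaleF c a) a ≡ scaleF (suc c) a
scaleF-suc {q} c a = ∼⇒≡ (addF-∼ (scaleF-∼ c toℕ-∼) toℕ-∼) (scaleF-∼ (suc c) toℕ-∼)
  (cong (_% q) (+-comm (c * toℕ a) (toℕ a)))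

scaleF-assoc : ∀ {q} .{{_ : NonZero q}} c d (a : Fin q) → scaleF c (scaleF d a) ≡ scaleF (c * d) a
scaleF-assoc {q} c d a = ∼⇒≡ (scaleF-∼ c (scaleF-∼ d toℕ-∼)) (scaleF-∼ (c * d) toℕ-∼)
  (cong (_% q) (sym (*-assoc c d (toℕ a))))

scaleF-cong : ∀ {q m c d} .{{_ : NonZero q}} .{{_ : NonZero m}} → q ∣ m → c % m ≡ d % m →
              (a : Fin q) → scaleF c a ≡ scaleF d a
scaleF-cong {q} {m} {c} {d} q∣m c≡d a =
  ∼⇒≡ (scaleF-∼ c toℕ-∼) (scaleF-∼ d toℕ-∼) (%-cong-* {c = toℕ a} c≡d′ refl)
  where
  c≡d′ : c % q ≡ d % q
  c≡d′ = trans (sym (m∣n⇒o%n%m≡o%m q m c q∣m)) (trans (cong (_% q) c≡d) (m∣n⇒o%n%m≡o%m q m d q∣m))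

-- The abelian group M = ℤ/q₁ × ⋯ × ℤ/q_t

addE-comm : ∀ qs → All NonZero qs → (x y : Elt qs) → addE qs x y ≡ addE qs y x
addE-comm []       []         _       _       = refl
addE-comm (q ∷ qs) (nz ∷ nzs) (a , x) (b , y) = cong₂ _,_ (addF-comm {{nz}} a b) (addE-comm qs nzs x y)

addE-identityˡ : ∀ qs (nzs : All NonZero qs) (x : Elt qs) → addE qs (zeroE qs nzs) x ≡ x
addE-identityˡ []       []         _       = refl
addE-identityˡ (q ∷ qs) (nz ∷ nzs) (a , x) = cong₂ _,_ (addF-identityˡ {{nz}} a) (addE-identityˡ qs nzs x)

addE-identityʳ : ∀ qs (nzs : All NonZero qs) (x : Elt qs) → addE qs x (zeroE qs nzs) ≡ x
addE-identityʳ qs nzs x = trans (addE-comm qs nzs x _) (addE-identityˡ qs nzs x)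

addE-cancelˡ : ∀ qs → All NonZero qs → (z : Elt qs) {x y : Elt qs} → addE qs z x ≡ addE qs z y → x ≡ y
addE-cancelˡ []       []         _       _  = refl
addE-cancelˡ (q ∷ qs) (nz ∷ nzs) (c , z) eq =
  cong₂ _,_ (addF-cancelˡ {{nz}} c (,-injectiveˡ eq)) (addE-cancelˡ qs nzs z (,-injectiveʳ eq))

scaleE-identityˡ : ∀ qs → All NonZero qs → (x : Elt qs) → scaleE qs 1 x ≡ x
scaleE-identityˡ []       []         _       = refl
scaleE-identityˡ (q ∷ qs) (nz ∷ nzs) (a , x) = cong₂ _,_ (scaleF-identityˡ {{nz}} a) (scaleE-identityˡ qs nzs x)

scaleE-zeroˡ : ∀ qs (nzs : All NonZero qs) (x : Elt qs) → scaleE qs 0 x ≡ zeroE qs nzs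
scaleE-zeroˡ []       []         _       = refl
scaleE-zeroˡ (q ∷ qs) (nz ∷ nzs) (a , x) = cong₂ _,_ (scaleF-zeroˡ {{nz}} a) (scaleE-zeroˡ qs nzs x)

scaleE-suc : ∀ qs → All NonZero qs → ∀ c (x : Elt qs) → addE qs (scaleE qs c x) x ≡ scaleE qs (suc c) x
scaleE-suc []       []         _ _       = refl
scaleE-suc (q ∷ qs) (nz ∷ nzs) c (a , x) = cong₂ _,_ (scaleF-suc {{nz}} c a) (scaleE-suc qs nzs c x)

scaleE-assoc : ∀ qs → All NonZero qs → ∀ c d (x : Elt qs) → scaleE qs c (scaleE qs d x) ≡ scaleE qs (c * d) x
scaleE-assoc []       []         _ _ _       = refl
scaleE-assoc (q ∷ qs) (nz ∷ nzs) c d (a , x) = cong₂ _,_ (scaleF-assoc {{nz}} c d a) (scaleE-assoc qs nzs c d x)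

scaleE-cong : ∀ qs → All NonZero qs → ∀ {m c d} .{{_ : NonZero m}} → All (_∣ m) qs →
              c % m ≡ d % m → (x : Elt qs) → scaleE qs c x ≡ scaleE qs d x
scaleE-cong []       []         []           _   _       = refl
scaleE-cong (q ∷ qs) (nz ∷ nzs) (q∣m ∷ qs∣m) c≡d (a , x) =
  cong₂ _,_ (scaleF-cong {{nz}} q∣m c≡d a) (scaleE-cong qs nzs qs∣m c≡d x)

module _ (qs : List ℕ) (nzs : All NonZero qs) {m : ℕ} .{{_ : NonZero m}} (qs∣m : All (_∣ m) qs) where

  scaleE-inverse : ∀ {c u} → c * u % m ≡ 1 % m → (x : Elt qs) → scaleE qs c (scaleE qs u x) ≡ x
  scaleE-inverse {c} {u} cu≡1 x = begin
    scaleE qs c (scaleE qs u x) ≡⟨ scaleE-assoc qs nzs c u x ⟩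
    scaleE qs (c * u) x         ≡⟨ scaleE-cong qs nzs qs∣m cu≡1 x ⟩
    scaleE qs 1 x               ≡⟨ scaleE-identityˡ qs nzs x ⟩
    x                           ∎
    where open ≡-Reasoning

  scaleE-injective : ∀ {c} → Coprime c m → {x y : Elt qs} → scaleE qs c x ≡ scaleE qs c y → x ≡ y
  scaleE-injective {c} c⊥m {x} {y} cx≡cy = begin
    x                           ≡⟨ scaleE-inverse uc≡1 x ⟨
    scaleE qs u (scaleE qs c x) ≡⟨ cong (scaleE qs u) cx≡cy ⟩
    scaleE qs u (scaleE qs c y) ≡⟨ scaleE-inverse uc≡1 y ⟩
    y                           ∎
    where
    open ≡-Reasoning
    u = proj₁ (coprime⇒inverse c⊥m)
    uc≡1 : u * c % m ≡ 1 % m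
    uc≡1 = trans (cong (_% m) (*-comm u c)) (proj₂ (coprime⇒inverse c⊥m))

  scaleE-∸1-surjective : ∀ {c} → 1 ≤ c → Coprime (c ∸ 1) m → ∀ x → ∃ λ y → scaleE qs c y ≡ addE qs y x
  scaleE-∸1-surjective {c} 1≤c c∸1⊥m x = y , (begin
    scaleE qs c y                   ≡⟨ cong (λ t → scaleE qs t y) (m+[n∸m]≡n 1≤c) ⟨
    scaleE qs (suc (c ∸ 1)) y       ≡⟨ scaleE-suc qs nzs (c ∸ 1) y ⟨
    addE qs (scaleE qs (c ∸ 1) y) y ≡⟨ cong (λ t → addE qs t y) (scaleE-inverse (proj₂ inverse) x) ⟩
    addE qs x y                     ≡⟨ addE-comm qs nzs x y ⟩
    addE qs y x                     ∎)
    where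
    open ≡-Reasoning
    inverse = coprime⇒inverse c∸1⊥m
    y = scaleE qs (proj₁ inverse) x

Elt-nontrivial : ∀ {q} qs (nz : NonZero q) nzs → q ≢ 1 → ∃ λ x → x ≢ zeroE (q ∷ qs) (nz ∷ nzs)
Elt-nontrivial {q} qs nz nzs q≢1 = (1 mod q , zeroE qs nzs) , λ eq → 0≢1+n (sym (begin
  1                 ≡⟨ m<n⇒m%n≡m 1<q ⟨
  1 % q             ≡⟨ toℕ-fromℕ< (m%n<n 1 q) ⟨
  toℕ (1 mod q)     ≡⟨ cong toℕ (,-injectiveˡ eq) ⟩
  toℕ (0 mod q)     ≡⟨ toℕ-fromℕ< (m%n<n 0 q) ⟩
  0 % q             ≡⟨ m<n⇒m%n≡m (>-nonZero⁻¹ q) ⟩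
  0                 ∎))
  where
  open ≡-Reasoning
  instance _ = nz
  1<q : 1 < q
  1<q = ≤∧≢⇒< (>-nonZero⁻¹ q) (≢-sym q≢1)

-- Commutators and automorphisms

module Commutators {G : Set} (_∙_ : G → G → G) (ε : G) (_⁻¹ : G → G) where

  open GroupNotions _∙_ ε _⁻¹ using (IsAut)

  pow : G → ℕ → G
  pow g zero    = ε
  pow g (suc d) = pow g d ∙ g

  -- g is the commutator u⁻¹ v⁻¹ u v, stated without inverses
  IsCommutator : G → Set
  IsCommutator g = ∃₂ λ u v → u ∙ v ≡ (v ∙ u) ∙ g

  ActsAsPower : ℕ → G → Set
  ActsAsPower d g = ∀ x → IsCommutator x → x ∙ g ≡ g ∙ pow x d

  module _ (∙-identityʳ : ∀ g → g ∙ ε ≡ g) (∙-cancelˡ : ∀ c {a b} → c ∙ a ≡ c ∙ b → a ≡ b)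
           {α : G → G} (α-aut : IsAut α) where

    private
      α-injective : ∀ {g h} → α g ≡ α h → g ≡ h
      α-injective = proj₁ (proj₁ α-aut)

      α-surjective : ∀ h → ∃ λ g → α g ≡ h
      α-surjective h = map₂ (λ α≡ → α≡ refl) (proj₂ (proj₁ α-aut) h)

      α-hom : ∀ g h → α (g ∙ h) ≡ α g ∙ α h
      α-hom = proj₂ α-aut

    α-≡⇔ : ∀ {a b a′ b′} → α a ≡ a′ → α b ≡ b′ → a ≡ b ⇔ a′ ≡ b′
    α-≡⇔ αa≡a′ αb≡b′ = mk⇔
      (λ a≡b → trans (sym αa≡a′) (trans (cong α a≡b) αb≡b′))
      (λ a′≡b′ → α-injective (trans αa≡a′ (trans a′≡b′ (sym αb≡b′))))

    α-ε : α ε ≡ ε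
    α-ε = ∙-cancelˡ (α ε) (begin
      α ε ∙ α ε ≡⟨ α-hom ε ε ⟨
      α (ε ∙ ε) ≡⟨ cong α (∙-identityʳ ε) ⟩
      α ε       ≡⟨ ∙-identityʳ (α ε) ⟨
      α ε ∙ ε   ∎)
      where open ≡-Reasoning

    α-pow : ∀ g d → α (pow g d) ≡ pow (α g) d
    α-pow g zero    = α-ε
    α-pow g (suc d) = trans (α-hom (pow g d) g) (cong (_∙ α g) (α-pow g d))

    ≡ε-α : ∀ g → g ≡ ε ⇔ α g ≡ ε
    ≡ε-α g = α-≡⇔ refl α-ε

    IsCommutator-α : ∀ g → IsCommutator g ⇔ IsCommutator (α g)
    IsCommutator-α g = mk⇔ image preimage
      where
      relation : ∀ u v → u ∙ v ≡ (v ∙ u) ∙ g ⇔ α u ∙ α v ≡ (α v ∙ α u) ∙ α g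
      relation u v = α-≡⇔ (α-hom u v) (trans (α-hom (v ∙ u) g) (cong (_∙ α g) (α-hom v u)))

      image : IsCommutator g → IsCommutator (α g)
      image (u , v , eq) = α u , α v , Equivalence.to (relation u v) eq

      preimage : IsCommutator (α g) → IsCommutator g
      preimage (u′ , v′ , eq) with α-surjective u′ | α-surjective v′
      ... | u , refl | v , refl = u , v , Equivalence.from (relation u v) eq

    ActsAsPower-α : ∀ d g → ActsAsPower d g ⇔ ActsAsPower d (α g)
    ActsAsPower-α d g = mk⇔ image preimage
      where
      relation : ∀ x → x ∙ g ≡ g ∙ pow x d ⇔ α x ∙ α g ≡ α g ∙ pow (α x) d
      relation x = α-≡⇔ (α-hom x g) (trans (α-hom g (pow x d)) (cong (α g ∙_) (α-pow x d)))

      image : ActsAsPower d g → ActsAsPower d (α g)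
      image acts x′ x′-comm with α-surjective x′
      ... | x , refl = Equivalence.to (relation x) (acts x (Equivalence.from (IsCommutator-α x) x′-comm))

      preimage : ActsAsPower d (α g) → ActsAsPower d g
      preimage acts x x-comm = Equivalence.from (relation x) (acts (α x) (Equivalence.to (IsCommutator-α x) x-comm))

-- Counting in a finite group

indicator : Bool → ℕ
indicator true  = 1
indicator false = 0

sum-δ : ∀ {n} (f : Fin n → ℕ) i → (∀ j → j ≢ i → f j ≡ 0) → sum f ≡ f i
sum-δ {suc n} f i f≡0 = begin
  sum f                      ≡⟨ sum-remove {i = i} f ⟩
  f i + sum (f ∘ punchIn i)  ≡⟨ cong (f i +_) (sum-cong-≗ (λ j → f≡0 _ (punchInᵢ≢i i j))) ⟩
  f i + sum {n} (λ _ → 0)    ≡⟨ cong (f i +_) (sum-replicate-zero n) ⟩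
  f i + 0                    ≡⟨ +-identityʳ (f i) ⟩
  f i                        ∎
  where open ≡-Reasoning

sum-const : ∀ k c → sum {k} (λ _ → c) ≡ k * c
sum-const zero    c = refl
sum-const (suc k) c = cong (c +_) (sum-const k c)

module Counting {G : Set} {N : ℕ} (enum : Fin N ↔ G) where

  open Inverse enum using (to; from; strictlyInverseˡ; strictlyInverseʳ)

  total : (G → ℕ) → ℕ
  total f = sum (f ∘ to)

  count : (G → Bool) → ℕ
  count O = total (indicator ∘ O)

  total-cong : ∀ {f g : G → ℕ} → (∀ x → f x ≡ g x) → total f ≡ total g
  total-cong f≗g = sum-cong-≗ (f≗g ∘ to)

  total-+ : ∀ (f h : G → ℕ) → total (λ g → f g + h g) ≡ total f + total h
  total-+ f h = ∑-distrib-+ (f ∘ to) (h ∘ to)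

  total-∘↔ : (α : G ↔ G) (f : G → ℕ) → total (f ∘ Inverse.to α) ≡ total f
  total-∘↔ α f = sym (trans (sum-permute (f ∘ to) π) (sum-cong-≗ (cong f ∘ strictlyInverseˡ ∘ Inverse.to α ∘ to)))
    where π = ↔-sym enum ↔-∘ (α ↔-∘ enum)

  _≟_ : DecidableEquality G
  _≟_ = via-injection (↔⇒↣ (↔-sym enum)) _≟ᶠ_

  all? : ∀ {P : G → Set} → (∀ g → Dec (P g)) → Dec (∀ g → P g)
  all? {P} P? = map′ (λ ∀j g → subst P (strictlyInverseˡ g) (∀j (from g))) (λ ∀g j → ∀g (to j))
                     (allᶠ? (P? ∘ to))

  count-≡ : ∀ g₀ → count (λ g → does (g ≟ g₀)) ≡ 1
  count-≡ g₀ = trans (sum-δ _ (from g₀) off-g₀)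
                     (cong indicator (dec-true (to (from g₀) ≟ g₀) (strictlyInverseˡ g₀)))
    where
    off-g₀ : ∀ j → j ≢ from g₀ → indicator (does (to j ≟ g₀)) ≡ 0
    off-g₀ j j≢ = cong indicator
      (dec-false (to j ≟ g₀) (λ eq → j≢ (trans (sym (strictlyInverseʳ j)) (cong from eq))))

  count-remove : ∀ {O} g₀ → O g₀ ≡ true → count O ≡ count (λ g → O g ∧ not (does (g ≟ g₀))) + 1
  count-remove {O} g₀ Og₀ = begin
    count O                    ≡⟨ total-cong split ⟩
    total (λ g → f g + δ g)    ≡⟨ total-+ f δ ⟩
    total f + total δ          ≡⟨ cong (total f +_) (count-≡ g₀) ⟩
    total f + 1                ∎
    where
    open ≡-Reasoning
    f δ : G → ℕ
    f g = indicator (O g ∧ not (does (g ≟ g₀)))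
    δ g = indicator (does (g ≟ g₀))

    split : ∀ g → indicator (O g) ≡ f g + δ g
    split g = by-cases (g ≟ g₀)
      where
      by-cases : (d : Dec (g ≡ g₀)) → indicator (O g) ≡ indicator (O g ∧ not (does d)) + indicator (does d)
      by-cases (yes refl) rewrite Og₀ = refl
      by-cases (no _)     = sym (trans (+-identityʳ _) (cong indicator (∧-identityʳ (O g))))

module CayleyPartition {G : Set} (_∙_ : G → G → G) (ε : G) (_⁻¹ : G → G) {N : ℕ} (enum : Fin N ↔ G) where

  open GroupNotions _∙_ ε _⁻¹
  open Counting enum

  AutInvariant : (G → Bool) → Set
  AutInvariant O = ∀ α → IsAut α → ∀ g → O (α g) ≡ O g

  IsCIGroup∧IsKIfCayley⇒∣count : ∀ {k S} → IsCIGroup → IsKIfCayley k S →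
                                  ∀ O → AutInvariant O → O ε ≡ false → k ∣ count O
  IsCIGroup∧IsKIfCayley⇒∣count {k} {S} isCI (P , (P-inv , _ , P-disjoint , P-cover) , (i₀ , Pi₀≗S) , P≅S)
                               O O-inv Oε≡false =
    divides c (begin
      count O                                   ≡⟨ total-cong split ⟩
      total (λ g → sum (λ i → part i g))        ≡⟨ ∑-comm (λ j i → part i (to j)) ⟩
      sum (λ i → total (part i))                ≡⟨ sum-cong-≗ part≡S ⟩
      sum {k} (λ _ → c)                         ≡⟨ sum-const k c ⟩
      k * c                                     ≡⟨ *-comm k c ⟩
      c * k                                     ∎)
    where
    open ≡-Reasoning
    open Inverse enum using (to)

    part : Fin k → G → ℕ
    part i g = indicator (P i g ∧ O g)

    c : ℕ
    c = count (λ g → S g ∧ O g)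

    S-inv : InvClosedNonId S
    S-inv = trans (sym (Pi₀≗S ε)) (proj₁ (P-inv i₀)) ,
            λ g Sg → trans (sym (Pi₀≗S _)) (proj₂ (P-inv i₀) g (trans (Pi₀≗S g) Sg))

    ε∉O : ∀ {g} → O g ≡ true → g ≢ ε
    ε∉O Og≡true refl with trans (sym Og≡true) Oε≡false
    ... | ()

    split : ∀ g → indicator (O g) ≡ sum (λ i → part i g)
    split g with O g in Og
    ... | false = sym (trans (sum-cong-≗ (λ i → cong indicator (∧-zeroʳ (P i g)))) (sum-replicate-zero k))
    ... | true with P-cover g (ε∉O Og)
    ...   | i , Pig = sym (trans (sum-δ _ i off-i) (cong (λ b → indicator (b ∧ true)) Pig))
      where
      off-i : ∀ j → j ≢ i → indicator (P j g ∧ true) ≡ 0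
      off-i j j≢i = cong (λ b → indicator (b ∧ true)) (P-disjoint i j g (≢-sym j≢i) Pig)

    part≡S : ∀ i → total (part i) ≡ c
    part≡S i with isCI (P i) S (P-inv i) S-inv (P≅S i)
    ... | α , α-aut , S∘α≡Pi = begin
      total (part i)                    ≡⟨ total-cong (λ g → cong₂ (λ a b → indicator (a ∧ b)) (sym (S∘α≡Pi g))
                                                                                             (sym (O-inv α α-aut g))) ⟩
      count ((λ g → S g ∧ O g) ∘ α)     ≡⟨ total-∘↔ (⤖⇒↔ (mk⤖ (proj₁ α-aut))) (indicator ∘ (λ g → S g ∧ O g)) ⟩
      c                                 ∎

-- The groups H_e(M, 2^r 3^s, l)

enumElt : ∀ qs → Fin (product qs) ↔ Elt qs
enumElt []       = 1↔⊤
enumElt (q ∷ qs) = (↔-id _ ×-↔ enumElt qs) ↔-∘ *↔×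

module Semidirect (qs : List ℕ) (nzs : All NonZero qs) (r s l : ℕ) where

  n : ℕ
  n = ordZ r s

  instance
    n≢0 : NonZero n
    n≢0 = ordZ-nz r s

  G : Set
  G = HCarrier qs r s

  _·_ : G → G → G
  _·_ = Hmul qs r s l

  ε : G
  ε = Hone qs nzs r s

  0ᴹ : Elt qs
  0ᴹ = zeroE qs nzs

  open Commutators _·_ ε (Hinv qs r s l)

  ι : Elt qs → G
  ι w = zeroF n , w

  scaleE-l^zeroF : ∀ y → scaleE qs (l ^ toℕ (zeroF n)) y ≡ y
  scaleE-l^zeroF y = trans (cong (λ t → scaleE qs (l ^ t) y) toℕ-zeroF) (scaleE-identityˡ qs nzs y)

  ι·-≡ : ∀ w c y → ι w · (c , y) ≡ (c , addE qs (scaleE qs (l ^ toℕ c) w) y)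
  ι·-≡ w c y = cong (_, addE qs (scaleE qs (l ^ toℕ c) w) y) (addF-identityˡ c)

  ·ι-≡ : ∀ c y w → (c , y) · ι w ≡ (c , addE qs y w)
  ·ι-≡ c y w = cong₂ _,_ (addF-identityʳ c) (cong (λ t → addE qs t w) (scaleE-l^zeroF y))

  ·-identityʳ : ∀ g → g · ε ≡ g
  ·-identityʳ (c , y) = trans (·ι-≡ c y 0ᴹ) (cong (c ,_) (addE-identityʳ qs nzs y))

  ·-cancelˡ : ∀ g {h h′} → g · h ≡ g · h′ → h ≡ h′
  ·-cancelˡ (c , y) {a , x} {a′ , x′} eq with addF-cancelˡ c (,-injectiveˡ eq)
  ... | refl = cong (a ,_) (addE-cancelˡ qs nzs _ (,-injectiveʳ eq))

  pow-ι : ∀ w d → pow (ι w) d ≡ ι (scaleE qs d w)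
  pow-ι w zero    = cong ι (sym (scaleE-zeroˡ qs nzs w))
  pow-ι w (suc d) = begin
    pow (ι w) d · ι w             ≡⟨ cong (_· ι w) (pow-ι w d) ⟩
    ι (scaleE qs d w) · ι w       ≡⟨ ·ι-≡ (zeroF n) (scaleE qs d w) w ⟩
    ι (addE qs (scaleE qs d w) w) ≡⟨ cong ι (scaleE-suc qs nzs d w) ⟩
    ι (scaleE qs (suc d) w)       ∎
    where open ≡-Reasoning

  ι-conjugate : ∀ w c y w′ → ι w · (c , y) ≡ (c , y) · ι w′ ⇔ scaleE qs (l ^ toℕ c) w ≡ w′
  ι-conjugate w c y w′ = mk⇔
    (λ eq → addE-cancelˡ qs nzs y (trans (addE-comm qs nzs y _)
              (,-injectiveʳ (trans (sym (ι·-≡ w c y)) (trans eq (·ι-≡ c y w′))))))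
    (λ eq → trans (ι·-≡ w c y) (trans (cong (c ,_) (trans (addE-comm qs nzs _ y) (cong (addE qs y) eq)))
              (sym (·ι-≡ c y w′))))

  IsCommutator⇒≡ι : ∀ {g} → IsCommutator g → g ≡ ι (proj₂ g)
  IsCommutator⇒≡ι {c , w} ((a , _) , (b , _) , eq) = cong (_, w) (addF-cancelˡ (addF b a)
    (trans (sym (,-injectiveˡ eq)) (trans (addF-comm a b) (sym (addF-identityʳ (addF b a))))))

  module _ {m : ℕ} .{{_ : NonZero m}} (qs∣m : All (_∣ m) qs) (l^n≡1 : l ^ n % m ≡ 1 % m)
           (1≤l : 1 ≤ l) (l⊥m : Coprime l m) (l∸1⊥m : Coprime (l ∸ 1) m) where

    scaleE-l^-cong : ∀ {a b} → a % n ≡ b % n → ∀ w → scaleE qs (l ^ a) w ≡ scaleE qs (l ^ b) w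
    scaleE-l^-cong {a} {b} a≡b = scaleE-cong qs nzs qs∣m (^-cong-% {l} {n} {m} l^n≡1 {a} {b} a≡b)

    z : Fin n
    z = 1 mod n

    scaleE-l^z : ∀ c w → scaleE qs (l ^ toℕ (addF z c)) w ≡ scaleE qs l (scaleE qs (l ^ toℕ c) w)
    scaleE-l^z c w = trans
      (scaleE-l^-cong {toℕ (addF z c)} {suc (toℕ c)} (_∼_.toℕ-% (addF-∼ {n} (mod-∼ 1) (toℕ-∼ {a = c}))) w)
      (sym (scaleE-assoc qs nzs l (l ^ toℕ c) w))

    -- ι w is the commutator of ι y and z, for y with l·y = y + w
    ι-IsCommutator : ∀ w → IsCommutator (ι w)
    ι-IsCommutator w with scaleE-∸1-surjective qs nzs qs∣m 1≤l l∸1⊥m w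
    ... | y , ly≡y+w = ι y , (z , 0ᴹ) , (begin
      ι y · (z , 0ᴹ)                             ≡⟨ ι·-≡ y z 0ᴹ ⟩
      (z , addE qs (scaleE qs (l ^ toℕ z) y) 0ᴹ) ≡⟨ cong (z ,_) (addE-identityʳ qs nzs _) ⟩
      (z , scaleE qs (l ^ toℕ z) y)              ≡⟨ cong (z ,_) (scaleE-l^-cong {toℕ z} {1} (_∼_.toℕ-% (mod-∼ {n} 1)) y) ⟩
      (z , scaleE qs (l ^ 1) y)                  ≡⟨ cong (λ t → z , scaleE qs t y) (*-identityʳ l) ⟩
      (z , scaleE qs l y)                        ≡⟨ cong (z ,_) ly≡y+w ⟩
      (z , addE qs y w)                          ≡⟨ cong (λ t → z , addE qs t w) (addE-identityˡ qs nzs y) ⟨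
      (z , addE qs (addE qs 0ᴹ y) w)             ≡⟨ ·ι-≡ z (addE qs 0ᴹ y) w ⟨
      (z , addE qs 0ᴹ y) · ι w                   ≡⟨ cong (_· ι w) (·ι-≡ z 0ᴹ y) ⟨
      ((z , 0ᴹ) · ι y) · ι w                     ∎)
      where open ≡-Reasoning

    ActsAsPower⇔ : ∀ d c y → ActsAsPower d (c , y) ⇔ (∀ w → scaleE qs (l ^ toℕ c) w ≡ scaleE qs d w)
    ActsAsPower⇔ d c y = mk⇔
      (λ acts w → Equivalence.to (acts-ι w) (acts (ι w) (ι-IsCommutator w)))
      (λ twists x x-comm → subst (λ x → x · (c , y) ≡ (c , y) · pow x d) (sym (IsCommutator⇒≡ι x-comm))
                             (Equivalence.from (acts-ι (proj₂ x)) (twists (proj₂ x))))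
      where
      acts-ι : ∀ w → ι w · (c , y) ≡ (c , y) · pow (ι w) d ⇔ scaleE qs (l ^ toℕ c) w ≡ scaleE qs d w
      acts-ι w = subst (λ h → (ι w · (c , y) ≡ (c , y) · h) ⇔ _) (sym (pow-ι w d))
                       (ι-conjugate w c y (scaleE qs d w))

    rotate↔ : G ↔ G
    rotate↔ = mk↔ₛ′ (λ (c , y) → addF z c , y) (λ (c , y) → addF (negF z) c , y)
                    (λ (c , y) → cong (_, y) (addF-negF-cancel z c)) (λ (c , y) → cong (_, y) (negF-addF-cancel z c))

    ActsAsPower-rotate : ∀ c y → ActsAsPower l (addF z c , y) ⇔ ActsAsPower 1 (c , y)
    ActsAsPower-rotate c y = mk⇔
      (λ acts → Equivalence.from (ActsAsPower⇔ 1 c y) (λ w → scaleE-injective qs nzs qs∣m l⊥m (begin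
        scaleE qs l (scaleE qs (l ^ toℕ c) w) ≡⟨ scaleE-l^z c w ⟨
        scaleE qs (l ^ toℕ (addF z c)) w      ≡⟨ Equivalence.to (ActsAsPower⇔ l _ y) acts w ⟩
        scaleE qs l w                         ≡⟨ cong (scaleE qs l) (scaleE-identityˡ qs nzs w) ⟨
        scaleE qs l (scaleE qs 1 w)           ∎)))
      (λ acts → Equivalence.from (ActsAsPower⇔ l _ y) (λ w → begin
        scaleE qs (l ^ toℕ (addF z c)) w      ≡⟨ scaleE-l^z c w ⟩
        scaleE qs l (scaleE qs (l ^ toℕ c) w) ≡⟨ cong (scaleE qs l) (Equivalence.to (ActsAsPower⇔ 1 c y) acts w) ⟩
        scaleE qs l (scaleE qs 1 w)           ≡⟨ cong (scaleE qs l) (scaleE-identityˡ qs nzs w) ⟩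
        scaleE qs l w                         ∎))
      where open ≡-Reasoning

    ActsAsPower-1-ε : ActsAsPower 1 ε
    ActsAsPower-1-ε = Equivalence.from (ActsAsPower⇔ 1 _ 0ᴹ)
      (λ w → trans (scaleE-l^zeroF w) (sym (scaleE-identityˡ qs nzs w)))

    ¬ActsAsPower-l-ε : (∃ λ w → w ≢ 0ᴹ) → ¬ ActsAsPower l ε
    ¬ActsAsPower-l-ε (w , w≢0) acts with scaleE-∸1-surjective qs nzs qs∣m 1≤l l∸1⊥m w
    ... | y , ly≡y+w = w≢0 (addE-cancelˡ qs nzs y (begin
      addE qs y w                         ≡⟨ ly≡y+w ⟨
      scaleE qs l y                       ≡⟨ Equivalence.to (ActsAsPower⇔ l _ 0ᴹ) acts y ⟨
      scaleE qs (l ^ toℕ (zeroF n)) y     ≡⟨ scaleE-l^zeroF y ⟩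
      y                                   ≡⟨ addE-identityʳ qs nzs y ⟨
      addE qs y 0ᴹ                        ∎))
      where open ≡-Reasoning

    ActsAsPower? : ∀ d g → Dec (ActsAsPower d g)
    ActsAsPower? d (c , y) = Dec.map (⇔-sym (ActsAsPower⇔ d c y))
      (all? (λ w → scaleE qs (l ^ toℕ c) w ≟ scaleE qs d w))
      where open Counting (enumElt qs)

    enumG : Fin (n * product qs) ↔ G
    enumG = (↔-id _ ×-↔ enumElt qs) ↔-∘ *↔×

    open GroupNotions _·_ ε (Hinv qs r s l) using (IsCIGroup; HasKIfProperty)
    open Counting enumG
    open CayleyPartition _·_ ε (Hinv qs r s l) enumG

    ¬HasKIfProperty : (∃ λ w → w ≢ 0ᴹ) → IsCIGroup → ∀ k → 2 ≤ k → ¬ HasKIfProperty k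
    ¬HasKIfProperty M≢0 isCI k 2≤k (S , kif) = <⇒≢ 2≤k (sym (∣1⇒≡1 k∣1))
      where
      twisted central central∖ε : G → Bool
      twisted g   = does (ActsAsPower? l g)
      central g   = does (ActsAsPower? 1 g)
      central∖ε g = central g ∧ not (does (g ≟ ε))

      invariant : ∀ d → AutInvariant (λ g → does (ActsAsPower? d g))
      invariant d α α-aut g =
        does-⇔ (⇔-sym (ActsAsPower-α ·-identityʳ ·-cancelˡ α-aut d g)) (ActsAsPower? d (α g)) (ActsAsPower? d g)

      central∖ε-invariant : AutInvariant central∖ε
      central∖ε-invariant α α-aut g = cong₂ (λ a b → a ∧ not b) (invariant 1 α α-aut g)
        (does-⇔ (⇔-sym (≡ε-α ·-identityʳ ·-cancelˡ α-aut g)) (α g ≟ ε) (g ≟ ε))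

      twisted∘rotate≗central : ∀ g → twisted (Inverse.to rotate↔ g) ≡ central g
      twisted∘rotate≗central (c , y) =
        does-⇔ (ActsAsPower-rotate c y) (ActsAsPower? l (addF z c , y)) (ActsAsPower? 1 (c , y))

      count-twisted : count twisted ≡ count central∖ε + 1
      count-twisted = begin
        count twisted                           ≡⟨ total-∘↔ rotate↔ (indicator ∘ twisted) ⟨
        count (twisted ∘ Inverse.to rotate↔)    ≡⟨ total-cong (cong indicator ∘ twisted∘rotate≗central) ⟩
        count central                           ≡⟨ count-remove {central} ε ε∈central ⟩
        count central∖ε + 1                     ∎
        where
        open ≡-Reasoning
        ε∈central = dec-true (ActsAsPower? 1 ε) ActsAsPower-1-ε

      k∣1 : k ∣ 1
      k∣1 = ∣m+n∣m⇒∣n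
        (subst (k ∣_) count-twisted
          (IsCIGroup∧IsKIfCayley⇒∣count isCI kif twisted (invariant l)
            (dec-false (ActsAsPower? l ε) (¬ActsAsPower-l-ε M≢0))))
        (IsCIGroup∧IsKIfCayley⇒∣count isCI kif central∖ε central∖ε-invariant
          (trans (cong (λ b → central ε ∧ not b) (dec-true (ε ≟ ε) refl)) (∧-zeroʳ (central ε))))

-- The parameter conditions

∣exponent : ∀ qs → All (_∣ exponent qs) qs
∣exponent []       = []
∣exponent (q ∷ qs) =
  m∣lcm[m,n] q (exponent qs) ∷ All.map (λ q′∣ → ∣-trans q′∣ (n∣lcm[m,n] q (exponent qs))) (∣exponent qs)

coprime-*⇒ˡ : ∀ {a b m} → Coprime (a * b) m → Coprime a m
coprime-*⇒ˡ {b = b} ab⊥m (d∣a , d∣m) = ab⊥m (∣-trans d∣a (m∣m*n b) , d∣m)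

coprime-*⇒ʳ : ∀ {a b m} → Coprime (a * b) m → Coprime b m
coprime-*⇒ʳ {a} {b} ab⊥m (d∣b , d∣m) = ab⊥m (∣-trans d∣b (divides a refl) , d∣m)

prime^≢1 : ∀ {p a} → Prime p → 1 ≤ a → p ^ a ≢ 1
prime^≢1 {p} {suc a} p-prime _ p^a≡1 = nonTrivial⇒≢1 {{prime⇒nonTrivial p-prime}} (m*n≡1⇒m≡1 p (p ^ a) p^a≡1)

TypeCondition⇒2≤e : ∀ {m e r s} → TypeCondition m e r s → 2 ≤ e
TypeCondition⇒2≤e (inj₁ (refl , _))               = s≤s (s≤s z≤n)
TypeCondition⇒2≤e (inj₂ (inj₁ (refl , _)))        = s≤s (s≤s z≤n)
TypeCondition⇒2≤e (inj₂ (inj₂ (inj₁ (refl , _)))) = s≤s (s≤s z≤n)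
TypeCondition⇒2≤e (inj₂ (inj₂ (inj₂ (refl , _)))) = s≤s (s≤s z≤n)

TypeCondition⇒e∣ordZ : ∀ {m e r s} → TypeCondition m e r s → e ∣ ordZ r s
TypeCondition⇒e∣ordZ (inj₁ (refl , s≤s {n = r} _ , refl , _)) =
  *-pres-∣ {2} {2 ^ suc r} {1} {1} (m∣m*n (2 ^ r)) (1∣ 1)
TypeCondition⇒e∣ordZ (inj₂ (inj₁ (refl , refl , s≤s {n = s} _ , _))) =
  *-pres-∣ {1} {1} {3} {3 ^ suc s} (1∣ 1) (m∣m*n (3 ^ s))
TypeCondition⇒e∣ordZ (inj₂ (inj₂ (inj₁ (refl , s≤s {n = suc r} (s≤s _) , refl , _)))) =
  *-pres-∣ {4} {2 ^ suc (suc r)} {1} {1} (*-pres-∣ {2} {2} {2} {2 ^ suc r} ∣-refl (m∣m*n (2 ^ r))) (1∣ 1)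
TypeCondition⇒e∣ordZ (inj₂ (inj₂ (inj₂ (refl , s≤s {n = r} _ , s≤s {n = s} _ , _)))) =
  *-pres-∣ {2} {2 ^ suc r} {3} {3 ^ suc s} (m∣m*n (2 ^ r)) (m∣m*n (3 ^ s))

^-%-one-multiple : ∀ {l e n m} .{{_ : NonZero m}} → l ^ e % m ≡ 1 % m → e ∣ n → l ^ n % m ≡ 1 % m
^-%-one-multiple {l} {e} {m = m} l^e≡1 (divides t refl) =
  trans (cong (_% m) (trans (cong (l ^_) (*-comm t e)) (sym (^-*-assoc l e t)))) (^-%-one t l^e≡1)

∣∸1⇒%≡1 : ∀ {a m} .{{_ : NonZero m}} → 1 ≤ a → m ∣ a ∸ 1 → a % m ≡ 1 % m
∣∸1⇒%≡1 {a} {m} 1≤a m∣a∸1 = trans (cong (_% m) (sym (m∸n+n≡m 1≤a))) (%-remove-+ˡ 1 m∣a∸1)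

lemma4p9 : (qs : List ℕ) (nzs : All NonZero qs) →
    PrimePowerFactors qs → HomocyclicSylows qs →
    (l e r s : ℕ) →
    1 ≤ l → l ≤ exponent qs → Coprime (l * (l ∸ 1)) (exponent qs) →
    IsMultOrder (exponent qs) l e →
    TypeCondition (exponent qs) e r s →
    H.IsCIGroup qs nzs r s l →
    (k : ℕ) → 2 ≤ k → ¬ H.HasKIfProperty qs nzs r s l k
-- For M = 1 the exponent is 1, which contradicts the minimality of e ≥ 2.
lemma4p9 [] _ _ _ l e r s _ _ _ (_ , _ , e-minimal) type _ _ _ _ =
  e-minimal 1 ≤-refl (TypeCondition⇒2≤e type) (1∣ _)
lemma4p9 (q ∷ qs) (q≢0 ∷ qs≢0) prime-powers _ l e r s 1≤l l≤m l[l∸1]⊥m (_ , m∣l^e∸1 , _) type isCI =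
  ¬HasKIfProperty (∣exponent (q ∷ qs)) l^n≡1 1≤l
    (coprime-*⇒ˡ {b = l ∸ 1} l[l∸1]⊥m) (coprime-*⇒ʳ {a = l} l[l∸1]⊥m)
    (Elt-nontrivial qs q≢0 qs≢0 q≢1) isCI
  where
  open Semidirect (q ∷ qs) (q≢0 ∷ qs≢0) r s l
  instance
    m≢0 : NonZero (exponent (q ∷ qs))
    m≢0 = >-nonZero (≤-trans 1≤l l≤m)
    l≢0 : NonZero l
    l≢0 = >-nonZero 1≤l
  l^n≡1 : l ^ ordZ r s % exponent (q ∷ qs) ≡ 1 % exponent (q ∷ qs)
  l^n≡1 = ^-%-one-multiple (∣∸1⇒%≡1 (m^n>0 l e) m∣l^e∸1) (TypeCondition⇒e∣ordZ type)
  q≢1 : q ≢ 1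
  q≢1 with prime-powers zero
  ... | p , a , p-prime , 1≤a , refl = prime^≢1 p-prime 1≤a
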